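{- If $G$ has girth at least $10hl$, then for every $0\le j\le h$ the graph $H_j$ is a tree.
   Context: $G$ is a $d$-regular graph on $n$ vertices, $l$ an integer with $l=\omega(1)$, $l=o(\log_d n)$, $h,k$ positive integers with $k\ge 4$ (in the paper $k=\max\{4,\lfloor l/\sqrt{\log_d n}\rfloor\}$). An $l$-walk is a path of length $l$ in $G$ (identified with its vertex set); a path of length at most $l$ with endpoints $u,v$ is written $[u,v]$. For an $l$-walk $W$, $\mathcal{P}_k(W)=\{[u_i,u_{i+1}]:0\le i\le k-1\}$ is a partition of $W$ into $k$ consecutive edge-disjoint subpaths, with $u_0,\dots,u_k$ in order along $W$ and $d(u_i,u_{i+1})\in\{\lfloor l/k\rfloor,\lceil l/k\rceil\}$. Witness construction: fix an $l$-walk $R$ (the root), and let $\mathcal{L}_0=\{R\}$. For each $P=[u_i,u_{i+1}]\in\mathcal{P}_k(R)$ let $W_P$ be an $l$-walk with $\emptyset\ne W_P\cap R\subseteq P\setminus\{u_i,u_{i+1}\}$; $R$ is its father, and $\mathcal{L}_1=\{W_P:P\in\mathcal{P}_k(R)\}$. For $2\le i\le h$: for each $W\in\mathcal{L}_{i-1}$ with father $W'$, call $P\in\mathcal{P}_k(W)$ free if it shares no vertex with $W'$, let $\mathcal{P}^0_k(W)$ be a set of $k-2$ free subpaths, and for each $P=[u,v]\in\mathcal{P}^0_k(W)$ let $W_P$ be an $l$-walk with $\emptyset\ne W_P\cap W\subseteq P\setminus\{u,v\}$ (father $W$); $\mathcal{L}_i=\bigcup_{W\in\mathcal{L}_{i-1}}\{W_P:P\in\mathcal{P}^0_k(W)\}$.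 (All these walks are assumed to exist.) $H_j$ is the graphical union (union of vertex sets and of edge sets) of all $l$-walks in $\mathcal{L}_0\cup\dots\cup\mathcal{L}_j$. -}

module Defs where

open import Data.Nat.Base using (ℕ; zero; suc; _+_; _*_; _∸_; _≤_; _<_; _/_; NonZero; >-nonZero)
open import Data.Fin.Base using (Fin; toℕ; inject₁; fromℕ) renaming (zero to fzero; suc to fsuc)
open import Data.List.Base using (length; filter; allFin)
open import Data.Product.Base using (Σ; ∃; ∃-syntax; _×_; _,_; proj₁)
open import Data.Sum.Base using (_⊎_)
open import Data.Unit.Base using (⊤; tt)
open import Relation.Nullary using (¬_)
open import Relation.Unary using (Decidable)
open import Relation.Binary.PropositionalEquality using (_≡_)
import Relation.Binary as B

record Graph (n : ℕ) : Set₁ where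
  field
    Adj   : Fin n → Fin n → Set
    adj?  : B.Decidable Adj
    sym   : ∀ {u v} → Adj u v → Adj v u
    irr   : ∀ {u} → ¬ Adj u u

degree : ∀ {n} → Graph n → Fin n → ℕ
degree G v = length (filter (Graph.adj? G v) (allFin _))

Regular : ∀ {n} → Graph n → ℕ → Set
Regular G d = ∀ v → degree G v ≡ d

WalkFromTo : ∀ {n} → (Fin n → Fin n → Set) → Fin n → Fin n → Set
WalkFromTo {n} E x y =
  Σ ℕ λ m → Σ (Fin (suc m) → Fin n) λ w →
    (w fzero ≡ x) × (w (fromℕ m) ≡ y) × (∀ (t : Fin m) → E (w (inject₁ t)) (w (fsuc t)))

IsCycle : ∀ {n} → (Fin n → Fin n → Set) → (m : ℕ) → (Fin (suc m) → Fin n) → Set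
IsCycle E m c =
  (3 ≤ m) × (c fzero ≡ c (fromℕ m))
  × (∀ (s t : Fin m) → c (inject₁ s) ≡ c (inject₁ t) → s ≡ t)
  × (∀ (t : Fin m) → E (c (inject₁ t)) (c (fsuc t)))

GirthAtLeast : ∀ {n} → Graph n → ℕ → Set
GirthAtLeast {n} G g = ∀ (m : ℕ) (c : Fin (suc m) → Fin n) → IsCycle (Graph.Adj G) m c → g ≤ m

IsTree : ∀ {n} → (Fin n → Set) → (Fin n → Fin n → Set) → Set
IsTree {n} V E =
  (∀ x y → V x → V y → WalkFromTo E x y)
  × (∀ (m : ℕ) (c : Fin (suc m) → Fin n) → ¬ IsCycle E m c)

IsLWalk : ∀ {n} → Graph n → (l : ℕ) → (Fin (suc l) → Fin n) → Set
IsLWalk G l w =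
  (∀ s t → w s ≡ w t → s ≡ t) × (∀ (t : Fin l) → Graph.Adj G (w (inject₁ t)) (w (fsuc t)))

-- Partitions P_k(W), given by the positions 0 = p_0 < p_1 < ... < p_k = l
-- of u_0, ..., u_k along the walk, with p_{i+1} - p_i ∈ {⌊l/k⌋, ⌈l/k⌉}

ceilDiv : (a b : ℕ) → .{{NonZero b}} → ℕ
ceilDiv a b = (a + (b ∸ 1)) / b

IsPartition : (l k : ℕ) → .{{NonZero k}} → (Fin (suc k) → Fin (suc l)) → Set
IsPartition l k p =
  (toℕ (p fzero) ≡ 0) × (toℕ (p (fromℕ k)) ≡ l)
  × (∀ (i : Fin k) → (toℕ (p (fsuc i)) ≡ toℕ (p (inject₁ i)) + l / k)
                    ⊎ (toℕ (p (fsuc i)) ≡ toℕ (p (inject₁ i)) + ceilDiv l k))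

OnSub : ∀ {n l k} → (Fin (suc l) → Fin n) → (Fin (suc k) → Fin (suc l)) → Fin k → Fin n → Set
OnSub w p i x = ∃[ t ] (toℕ (p (inject₁ i)) ≤ toℕ t × toℕ t ≤ toℕ (p (fsuc i)) × w t ≡ x)

InInterior : ∀ {n l k} → (Fin (suc l) → Fin n) → (Fin (suc k) → Fin (suc l)) → Fin k → Fin n → Set
InInterior w p i x = ∃[ t ] (toℕ (p (inject₁ i)) < toℕ t × toℕ t < toℕ (p (fsuc i)) × w t ≡ x)

OnWalk : ∀ {n l} → (Fin (suc l) → Fin n) → Fin n → Set
OnWalk w x = ∃[ t ] w t ≡ x

HangsOn : ∀ {n l k} → (Fin (suc l) → Fin n) → (Fin (suc l) → Fin n) → (Fin (suc k) → Fin (suc l)) → Fin k → Set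
HangsOn C w p i =
  (∃[ x ] (OnWalk C x × OnWalk w x))
  × (∀ x → OnWalk C x → OnWalk w x → InInterior w p i x)

-- Addresses of the walks in the levels L_0, L_1, ...:
-- L_0 : the root; L_1 : one walk per a : Fin k;
-- L_{i+2} : pairs (a , c) with a a node of L_{i+1} and c : Fin (k-2)

Addr : ℕ → ℕ → Set
Addr k zero = ⊤
Addr k (suc zero) = Fin k
Addr k (suc (suc i)) = Addr k (suc i) × Fin (k ∸ 2)

father : ∀ {k} i → Addr k (suc i) → Addr k i
father zero a = tt
father (suc i) (a , c) = a

-- The witness construction of depth h.  All data is given at every level,
-- but constraints are only imposed on levels 0..h.
record Witness {n : ℕ} (G : Graph n) (l k h : ℕ) .{{_ : NonZero k}} : Set where
  field
    walk  : (i : ℕ) → Addr k i → Fin (suc l) → Fin n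
    part  : (i : ℕ) → Addr k i → Fin (suc k) → Fin (suc l)
    -- for a node W at level i+1 (i+1 ≥ 1): the chosen k-2 free subpaths P^0_k(W)
    sel   : (i : ℕ) → Addr k (suc i) → Fin (k ∸ 2) → Fin k

    walk-ok : ∀ i → i ≤ h → (a : Addr k i) → IsLWalk G l (walk i a)
    part-ok : ∀ i → i ≤ h → (a : Addr k i) → IsPartition l k (part i a)
    level1  : 1 ≤ h → (a : Fin k) →
              HangsOn (walk 1 a) (walk 0 tt) (part 0 tt) a
    sel-inj  : ∀ i → suc (suc i) ≤ h → (a : Addr k (suc i)) →
               ∀ c c′ → sel i a c ≡ sel i a c′ → c ≡ c′
    sel-free : ∀ i → suc (suc i) ≤ h → (a : Addr k (suc i)) → (c : Fin (k ∸ 2)) →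
               ∀ x → OnSub (walk (suc i) a) (part (suc i) a) (sel i a c) x →
               ¬ OnWalk (walk i (father i a)) x
    levelSS  : ∀ i → suc (suc i) ≤ h → (a : Addr k (suc i)) → (c : Fin (k ∸ 2)) →
               HangsOn (walk (suc (suc i)) (a , c)) (walk (suc i) a) (part (suc i) a) (sel i a c)

  VH : ℕ → Fin n → Set
  VH j x = ∃[ i ] (i ≤ j × ∃[ a ] OnWalk (walk i a) x)

  EH : ℕ → Fin n → Fin n → Set
  EH j x y = ∃[ i ] (i ≤ j × ∃[ a ] ∃[ t ]
               ((walk i a (inject₁ t) ≡ x × walk i a (fsuc t) ≡ y)
                ⊎ (walk i a (inject₁ t) ≡ y × walk i a (fsuc t) ≡ x)))

module Submission where

-- Every vertex of H_j is joined to the first vertex r of the root walk, inside H_j, by a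
-- walk of length at most D = (1 + 2j) l: run along your own l-walk to the vertex it
-- shares with its father and recurse.  Since the girth exceeds 2D + 2, two distinct
-- simple paths to r of length at most D + 1 would close a short cycle, so such paths
-- are unique; consequently, along each edge of H_j the path of one endpoint extends
-- the path of the other by that edge.  Going around a cycle of H_j, the path lengths
-- change by ±1 at every step, so somewhere they rise and then immediately fall, which
-- makes two vertices at distance two on the cycle equal.  Hence H_j, connected through
-- r, has no cycles.

open import Defs
open import Data.Nat.Base using (ℕ; zero; suc; _+_; _*_; _≤_; _<_; z≤n; s≤s; NonZero)
open import Data.Nat.Properties
  using ( ≤-refl; ≤-reflexive; ≤-trans; ≤-antisym; <⇒≤; ≤⇒≯; ≮⇒≥; _<?_; n≤1+n; n<1+n
        ; m≤n⇒m≤1+n; m≤m+n; +-comm; +-suc; +-identityʳ; m≢1+n+m; +-mono-≤; +-monoʳ-≤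
        ; *-monoˡ-≤; *-monoʳ-≤; module ≤-Reasoning )
open import Data.Nat.Tactic.RingSolver using (solve-∀)
open import Data.Fin.Base using (Fin; toℕ; inject₁; fromℕ; fromℕ<) renaming (zero to fzero; suc to fsuc)
open import Data.Fin.Properties using (_≟_; toℕ≤pred[n]; toℕ-injective; toℕ-inject₁; toℕ-fromℕ<)
open import Data.List.Base using (List; []; _∷_; _++_; _∷ʳ_; [_]; length; reverse; head)
open import Data.List.Properties
  using (≡-dec; ∷-injectiveˡ; ++-assoc; unfold-reverse; length-++; length-reverse; length-++-≤ʳ)
open import Data.List.Membership.Propositional using (_∈_; _∉_)
open import Data.List.Membership.Propositional.Properties using (∈-∃++; ∈-++⁺ˡ; ∈-++⁺ʳ; ∈-++⁻)
open import Data.List.Relation.Binary.Disjoint.Propositional using (Disjoint)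
open import Data.List.Relation.Unary.All as All using (All; []; _∷_)
open import Data.List.Relation.Unary.All.Properties using (++⁻ˡ; ¬Any⇒All¬)
open import Data.List.Relation.Unary.Any using (here; there)
open import Data.List.Relation.Unary.Any.Properties using (reverse⁻)
import Data.List.Relation.Unary.First as First
open import Data.List.Relation.Unary.First.Properties using (toView)
open import Data.List.Relation.Unary.Linked using (Linked; []; [-]; _∷_)
open import Data.List.Relation.Unary.Unique.Propositional using (Unique; []; _∷_)
open import Data.List.Relation.Unary.Unique.Propositional.Properties using (++⁺; Unique[x∷xs]⇒x∉xs)
open import Data.Maybe.Properties using (just-injective)
open import Data.Product.Base using (∃-syntax; _×_; _,_; proj₁; proj₂)
open import Data.Sum.Base using (_⊎_; inj₁; inj₂; swap)
open import Data.Unit.Base using (tt)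
open import Data.Empty using (⊥; ⊥-elim)
open import Function.Base using (_∘_)
open import Level using (0ℓ)
open import Relation.Binary.Core using (Rel)
open import Relation.Binary.Definitions using (Symmetric)
open import Relation.Binary.PropositionalEquality
  using (_≡_; _≢_; refl; sym; trans; cong; cong₂; subst; subst₂; module ≡-Reasoning)
open import Relation.Nullary using (¬_; yes; no)
open import Relation.Nullary.Decidable.Core using (toSum)

data Walk {A : Set} (R : Rel A 0ℓ) : A → A → ℕ → Set where
  ε   : ∀ {x} → Walk R x x 0
  _◅_ : ∀ {x y z k} → R x y → Walk R y z k → Walk R x z (suc k)

infixr 5 _◅_

module _ {A : Set} {R : Rel A 0ℓ} where

  infixr 5 _◅◅_
  _◅◅_ : ∀ {x y z k k′} → Walk R x y k → Walk R y z k′ → Walk R x z (k + k′)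
  ε       ◅◅ q = q
  (e ◅ p) ◅◅ q = e ◅ (p ◅◅ q)

  reverseʷ : Symmetric R → ∀ {x y k} → Walk R x y k → Walk R y x k
  reverseʷ R-sym ε                 = ε
  reverseʷ R-sym (_◅_ {k = k} e p) =
    subst (Walk R _ _) (+-comm k 1) (reverseʷ R-sym p ◅◅ R-sym e ◅ ε)

  prefixWalk : ∀ {m} (w : Fin (suc m) → A) → (∀ t → R (w (inject₁ t)) (w (fsuc t))) →
               ∀ t → Walk R (w fzero) (w t) (toℕ t)
  prefixWalk             w steps fzero    = ε
  prefixWalk {m = suc m} w steps (fsuc t) =
    steps fzero ◅ prefixWalk (λ i → w (fsuc i)) (λ i → steps (fsuc i)) t

  vertex : ∀ {x y k} → Walk R x y k → Fin (suc k) → A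
  vertex {x} _       fzero    = x
  vertex     (_ ◅ p) (fsuc i) = vertex p i

  vertex-last : ∀ {x y k} (p : Walk R x y k) → vertex p (fromℕ k) ≡ y
  vertex-last ε       = refl
  vertex-last (_ ◅ p) = vertex-last p

  vertex-step : ∀ {x y k} (p : Walk R x y k) (t : Fin k) → R (vertex p (inject₁ t)) (vertex p (fsuc t))
  vertex-step (e ◅ p) fzero    = e
  vertex-step (e ◅ p) (fsuc t) = vertex-step p t

mapʷ : ∀ {A} {R S : Rel A 0ℓ} → (∀ {x y} → R x y → S x y) → ∀ {x y k} → Walk R x y k → Walk S x y k
mapʷ f ε       = ε
mapʷ f (e ◅ p) = f e ◅ mapʷ f p

toWalkFromTo : ∀ {n} {R : Rel (Fin n) 0ℓ} {x y k} → Walk R x y k → WalkFromTo R x y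
toWalkFromTo {k = k} p = k , vertex p , refl , vertex-last p , vertex-step p

module _ {A : Set} {R : Rel A 0ℓ} where

  Linked-join : ∀ xs {y ys} → Linked R (xs ∷ʳ y) → Linked R (y ∷ ys) → Linked R (xs ++ y ∷ ys)
  Linked-join []            _         q = q
  Linked-join (x ∷ [])      (e ∷ [-]) q = e ∷ q
  Linked-join (x ∷ x′ ∷ xs) (e ∷ p)   q = e ∷ Linked-join (x′ ∷ xs) p q

  Linked-reverse : Symmetric R → ∀ {x y} xs → Linked R (x ∷ xs ∷ʳ y) → Linked R (y ∷ reverse xs ∷ʳ x)
  Linked-reverse R-sym         []        (e ∷ [-]) = R-sym e ∷ [-]
  Linked-reverse R-sym {x} {y} (x′ ∷ xs) (e ∷ p)   =
    subst (λ zs → Linked R (y ∷ zs ∷ʳ x)) (sym (unfold-reverse x′ xs))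
      (subst (Linked R) (cong (y ∷_) (sym (++-assoc (reverse xs) [ x′ ] [ x ])))
        (Linked-join (y ∷ reverse xs) (Linked-reverse R-sym xs p) (R-sym e ∷ [-])))

module _ {A : Set} where

  Unique-++⁻ : ∀ xs {ys : List A} → Unique (xs ++ ys) → Unique xs × Unique ys × Disjoint xs ys
  Unique-++⁻ []       u        = [] , u , λ ()
  Unique-++⁻ (x ∷ xs) (x∉ ∷ u) with Unique-++⁻ xs u
  ... | uxs , uys , xs#ys = ++⁻ˡ xs x∉ ∷ uxs , uys , λ
    { (here refl , v∈ys)  → All.lookup x∉ (∈-++⁺ʳ xs v∈ys) refl
    ; (there v∈xs , v∈ys) → xs#ys (v∈xs , v∈ys) }

  Unique-reverse : ∀ {xs : List A} → Unique xs → Unique (reverse xs)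
  Unique-reverse {[]}     _        = []
  Unique-reverse {x ∷ xs} (x∉ ∷ u) rewrite unfold-reverse x xs =
    ++⁺ (Unique-reverse u) ([] ∷ []) λ { (x∈ , here refl) → All.lookup x∉ (reverse⁻ x∈) refl }

  lookup∷ʳ : (xs : List A) → A → Fin (suc (length xs)) → A
  lookup∷ʳ []       y _        = y
  lookup∷ʳ (x ∷ xs) y fzero    = x
  lookup∷ʳ (x ∷ xs) y (fsuc i) = lookup∷ʳ xs y i

  lookup∷ʳ-last : ∀ xs y → lookup∷ʳ xs y (fromℕ (length xs)) ≡ y
  lookup∷ʳ-last []       y = refl
  lookup∷ʳ-last (x ∷ xs) y = lookup∷ʳ-last xs y

  lookup∷ʳ-∈ : ∀ xs y (s : Fin (length xs)) → lookup∷ʳ xs y (inject₁ s) ∈ xs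
  lookup∷ʳ-∈ (x ∷ xs) y fzero    = here refl
  lookup∷ʳ-∈ (x ∷ xs) y (fsuc s) = there (lookup∷ʳ-∈ xs y s)

  lookup∷ʳ-injective : ∀ {xs} y → Unique xs → ∀ s t →
                       lookup∷ʳ xs y (inject₁ s) ≡ lookup∷ʳ xs y (inject₁ t) → s ≡ t
  lookup∷ʳ-injective {x ∷ xs} y _         fzero    fzero    _  = refl
  lookup∷ʳ-injective {x ∷ xs} y (x∉ ∷ _)  fzero    (fsuc t) eq = ⊥-elim (All.lookup x∉ (lookup∷ʳ-∈ xs y t) eq)
  lookup∷ʳ-injective {x ∷ xs} y (x∉ ∷ _)  (fsuc s) fzero    eq =
    ⊥-elim (All.lookup x∉ (lookup∷ʳ-∈ xs y s) (sym eq))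
  lookup∷ʳ-injective {x ∷ xs} y (_ ∷ uxs) (fsuc s) (fsuc t) eq = cong fsuc (lookup∷ʳ-injective y uxs s t eq)

  lookup∷ʳ-step : ∀ {R : Rel A 0ℓ} xs {y} → Linked R (xs ∷ʳ y) →
                  ∀ t → R (lookup∷ʳ xs y (inject₁ t)) (lookup∷ʳ xs y (fsuc t))
  lookup∷ʳ-step (x ∷ [])      (e ∷ [-]) fzero    = e
  lookup∷ʳ-step (x ∷ x′ ∷ xs) (e ∷ _)   fzero    = e
  lookup∷ʳ-step (x ∷ x′ ∷ xs) (_ ∷ p)   (fsuc t) = lookup∷ʳ-step (x′ ∷ xs) p t

  cycle-shorter : ∀ u (z : A) w v w′ →
                  length (u ++ z ∷ reverse v) < length (u ++ z ∷ w) + length (v ++ z ∷ w′)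
  cycle-shorter u z w v w′ = begin-strict
    length (u ++ z ∷ reverse v)                                ≡⟨ length-++ u ⟩
    length u + suc (length (reverse v))                        ≡⟨ cong (λ k → length u + suc k) (length-reverse v) ⟩
    length u + suc (length v)                                  <⟨ n<1+n _ ⟩
    suc (length u + suc (length v))                            ≡⟨ suc-+-suc (length u) (length v) ⟩
    (length u + 1) + (length v + 1)                            ≤⟨ +-mono-≤ (+-monoʳ-≤ (length u) (s≤s z≤n))
                                                                           (+-monoʳ-≤ (length v) (s≤s z≤n)) ⟩
    (length u + suc (length w)) + (length v + suc (length w′)) ≡⟨ cong₂ _+_ (length-++ u) (length-++ v) ⟨
    length (u ++ z ∷ w) + length (v ++ z ∷ w′)                 ∎
    where
    open ≤-Reasoning
    suc-+-suc : ∀ a b → suc (a + suc b) ≡ (a + 1) + (b + 1)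
    suc-+-suc = solve-∀

  Unique-cycle : ∀ {a z : A} u w v w′ → Unique (a ∷ u ++ z ∷ w) → Unique (a ∷ v ++ z ∷ w′) →
                 All (_∉ v ++ z ∷ w′) u → Unique (a ∷ u ++ z ∷ reverse v)
  Unique-cycle {a} {z} u w v w′ uP@(_ ∷ uP′) uQ@(_ ∷ uQ′) u∉Q =
    ¬Any⇒All¬ _ a∉cycle ∷
      ++⁺ (proj₁ (Unique-++⁻ u uP′)) (¬Any⇒All¬ _ z∉rv ∷ Unique-reverse uv) u#back
    where
    uv : Unique v
    uv = proj₁ (Unique-++⁻ v uQ′)
    z∉rv : z ∉ reverse v
    z∉rv z∈ = proj₂ (proj₂ (Unique-++⁻ v uQ′)) (reverse⁻ z∈ , here refl)
    back⊆Q : ∀ {y} → y ∈ z ∷ reverse v → y ∈ v ++ z ∷ w′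
    back⊆Q (here refl) = ∈-++⁺ʳ v (here refl)
    back⊆Q (there y∈)  = ∈-++⁺ˡ (reverse⁻ {xs = v} y∈)
    u#back : Disjoint u (z ∷ reverse v)
    u#back (y∈u , y∈back) = All.lookup u∉Q y∈u (back⊆Q y∈back)
    a∉cycle : a ∉ u ++ z ∷ reverse v
    a∉cycle a∈ with ∈-++⁻ u a∈
    ... | inj₁ a∈u    = Unique[x∷xs]⇒x∉xs uP (∈-++⁺ˡ a∈u)
    ... | inj₂ a∈back = Unique[x∷xs]⇒x∉xs uQ (back⊆Q a∈back)

closedWalk-isCycle : ∀ {n} {R : Rel (Fin n) 0ℓ} x xs → Linked R (x ∷ xs ∷ʳ x) → Unique (x ∷ xs) →
                     2 ≤ length xs → IsCycle R (suc (length xs)) (lookup∷ʳ (x ∷ xs) x)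
closedWalk-isCycle x xs linked unique 2≤ =
  s≤s 2≤ , sym (lookup∷ʳ-last xs x) , lookup∷ʳ-injective x unique , lookup∷ʳ-step (x ∷ xs) linked

-- Unit steps around a closed walk

module _ {m : ℕ} {height : ℕ → ℕ} {Up Down : ℕ → Set}
         (step : ∀ i → i ≤ m → Up i ⊎ Down i)
         (up : ∀ {i} → Up i → height (suc i) ≡ suc (height i))
         (down : ∀ {i} → Down i → height i ≡ suc (height (suc i)))
         (no-peak : ∀ i → suc i ≤ m → Up i → Down (suc i) → ⊥)
         (no-wrapped-peak : Up m → Down 0 → ⊥)
         where

  private
    ascending : Up 0 → ∀ i → i ≤ m → Up i × height (suc i) ≡ suc i + height 0
    ascending up₀ zero    _   = up₀ , up up₀
    ascending up₀ (suc i) i<m with ascending up₀ i (<⇒≤ i<m) | step (suc i) i<m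
    ... | upᵢ , hᵢ | inj₁ upᵢ₊₁   = upᵢ₊₁ , trans (up upᵢ₊₁) (cong suc hᵢ)
    ... | upᵢ , _  | inj₂ downᵢ₊₁ = ⊥-elim (no-peak i i<m upᵢ downᵢ₊₁)

    descending : Down m → ∀ k i → i + k ≡ m → Down i × height i ≡ suc k + height (suc m)
    descending downₘ zero i i+0≡m rewrite trans (sym (+-identityʳ i)) i+0≡m = downₘ , down downₘ
    descending downₘ (suc k) i i+1+k≡m =
      extend (descending downₘ k (suc i) 1+i+k≡m) (step i (<⇒≤ i<m))
      where
      1+i+k≡m : suc i + k ≡ m
      1+i+k≡m = trans (sym (+-suc i k)) i+1+k≡m
      i<m : i < m
      i<m = subst (suc i ≤_) 1+i+k≡m (m≤m+n (suc i) k)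
      extend : Down (suc i) × height (suc i) ≡ suc k + height (suc m) → Up i ⊎ Down i →
               Down i × height i ≡ suc (suc k) + height (suc m)
      extend (downᵢ₊₁ , _) (inj₁ upᵢ)   = ⊥-elim (no-peak i i<m upᵢ downᵢ₊₁)
      extend (_ , hᵢ₊₁)    (inj₂ downᵢ) = downᵢ , trans (down downᵢ) (cong suc hᵢ₊₁)

  peakless-steps-not-closed : height (suc m) ≢ height 0
  peakless-steps-not-closed closed with step 0 z≤n | step m ≤-refl
  ... | inj₁ up₀   | _         = m≢1+n+m (height 0) (trans (sym closed) (proj₂ (ascending up₀ m ≤-refl)))
  ... | inj₂ down₀ | inj₁ upₘ  = no-wrapped-peak upₘ down₀
  ... | inj₂ _     | inj₂ downₘ =
    m≢1+n+m (height 0) (trans (proj₂ (descending downₘ m 0 refl)) (cong (λ h → suc m + h) closed))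

-- Vertices of a cycle, indexed by ℕ

clamp : (m : ℕ) → ℕ → Fin (suc m)
clamp zero    _       = fzero
clamp (suc m) zero    = fzero
clamp (suc m) (suc i) = fsuc (clamp m i)

toℕ-clamp : ∀ m {i} → i ≤ m → toℕ (clamp m i) ≡ i
toℕ-clamp zero    z≤n       = refl
toℕ-clamp (suc m) z≤n       = refl
toℕ-clamp (suc m) (s≤s i≤m) = cong suc (toℕ-clamp m i≤m)

clamp-saturates : ∀ m {i} → m ≤ i → clamp m i ≡ fromℕ m
clamp-saturates zero    _         = refl
clamp-saturates (suc m) (s≤s m≤i) = cong fsuc (clamp-saturates m m≤i)

clamp-inject₁ : ∀ {m i} (i<m : i < m) → clamp m i ≡ inject₁ (fromℕ< i<m)
clamp-inject₁ {m} {i} i<m = toℕ-injective (begin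
  toℕ (clamp m i)             ≡⟨ toℕ-clamp m (<⇒≤ i<m) ⟩
  i                           ≡⟨ sym (toℕ-fromℕ< i<m) ⟩
  toℕ (fromℕ< i<m)            ≡⟨ sym (toℕ-inject₁ (fromℕ< i<m)) ⟩
  toℕ (inject₁ (fromℕ< i<m))  ∎)
  where open ≡-Reasoning

clamp-fsuc : ∀ {m i} (i<m : i < m) → clamp m (suc i) ≡ fsuc (fromℕ< i<m)
clamp-fsuc {m} {i} i<m = toℕ-injective (trans (toℕ-clamp m i<m) (cong suc (sym (toℕ-fromℕ< i<m))))

module CycleVertices {n : ℕ} {E : Rel (Fin n) 0ℓ} {m′ : ℕ} {c : Fin (suc (suc m′)) → Fin n}
                     (cycle : IsCycle E (suc m′) c) where

  m : ℕ
  m = suc m′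

  at : ℕ → Fin n
  at i = c (clamp m i)

  private
    3≤m : 3 ≤ m
    3≤m = proj₁ cycle

    c-injective : ∀ (s t : Fin m) → c (inject₁ s) ≡ c (inject₁ t) → s ≡ t
    c-injective = proj₁ (proj₂ (proj₂ cycle))

    at-injective : ∀ {i j} → i < m → j < m → at i ≡ at j → i ≡ j
    at-injective {i} {j} i<m j<m atᵢ≡atⱼ = begin
      i                 ≡⟨ toℕ-fromℕ< i<m ⟨
      toℕ (fromℕ< i<m)  ≡⟨ cong toℕ (c-injective _ _
                             (subst₂ (λ s t → c s ≡ c t) (clamp-inject₁ i<m) (clamp-inject₁ j<m) atᵢ≡atⱼ)) ⟩
      toℕ (fromℕ< j<m)  ≡⟨ toℕ-fromℕ< j<m ⟩
      j                 ∎
      where open ≡-Reasoning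

    not-short : ∀ {k} → k ≤ 2 → m ≢ k
    not-short k≤2 m≡k = ≤⇒≯ k≤2 (subst (3 ≤_) m≡k 3≤m)

  at-saturates : ∀ {i} → m ≤ i → at i ≡ at 0
  at-saturates m≤i = trans (cong c (clamp-saturates m m≤i)) (sym (proj₁ (proj₂ cycle)))

  at-step : ∀ {i} → i < m → E (at i) (at (suc i))
  at-step i<m = subst₂ E (cong c (sym (clamp-inject₁ i<m))) (cong c (sym (clamp-fsuc i<m)))
                         (proj₂ (proj₂ (proj₂ cycle)) (fromℕ< i<m))

  step-from : ∀ i → ∃[ y ] E (at i) y
  step-from i with i <? m
  ... | yes i<m = _ , at-step i<m
  ... | no  i≮m = _ , subst (λ x → E x (at 1)) (sym (at-saturates (≮⇒≥ i≮m))) (at-step (s≤s z≤n))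

  private
    revisit : ∀ {i j} → i < m → j ≤ m → at i ≡ at j → j ≡ i ⊎ (i ≡ 0 × j ≡ m)
    revisit {i} {j} i<m j≤m atᵢ≡atⱼ with j <? m
    ... | yes j<m = inj₁ (at-injective j<m i<m (sym atᵢ≡atⱼ))
    ... | no  j≮m =
      inj₂ (at-injective i<m (s≤s z≤n) (trans atᵢ≡atⱼ (at-saturates (≮⇒≥ j≮m))) ,
            ≤-antisym j≤m (≮⇒≥ j≮m))

  two-apart-distinct : ∀ i → suc (suc i) ≤ m → at i ≢ at (suc (suc i))
  two-apart-distinct i 2+i≤m atᵢ≡atᵢ₊₂ with revisit (≤-trans (n≤1+n _) 2+i≤m) 2+i≤m atᵢ≡atᵢ₊₂
  ... | inj₁ 2+i≡i         = m≢1+n+m i (sym 2+i≡i)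
  ... | inj₂ (i≡0 , 2+i≡m) = not-short ≤-refl (trans (sym 2+i≡m) (cong (λ k → suc (suc k)) i≡0))

  two-apart-across-start : at m′ ≢ at 1
  two-apart-across-start atₘ′≡at₁ with revisit ≤-refl (s≤s z≤n) atₘ′≡at₁
  ... | inj₁ 1≡m′      = not-short ≤-refl (cong suc (sym 1≡m′))
  ... | inj₂ (_ , 1≡m) = not-short (s≤s z≤n) (sym 1≡m)

-- Routes to a root in a graph of large girth

module Routes {n : ℕ} (G : Graph n) (r : Fin n) where
  open Graph G renaming (sym to Adj-sym)
  open import Data.List.Membership.DecPropositional (_≟_ {n}) using (_∈?_)

  data Route : Fin n → List (Fin n) → Set where
    []  : Route r []
    _∷_ : ∀ {x y P} → Adj x y → Route y P → Route x (y ∷ P)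

  root-∈ : ∀ {x P} → Route x P → r ∈ x ∷ P
  root-∈ []      = here refl
  root-∈ (_ ∷ ρ) = there (root-∈ ρ)

  Route-drop : ∀ {x y} pre {suf} → Route x (pre ++ y ∷ suf) → Route y suf
  Route-drop []        (_ ∷ ρ) = ρ
  Route-drop (_ ∷ pre) (_ ∷ ρ) = Route-drop pre ρ

  Route⇒Linked : ∀ {x z} u {w} → Route x (u ++ z ∷ w) → Linked Adj (x ∷ u ∷ʳ z)
  Route⇒Linked []      (e ∷ _) = e ∷ [-]
  Route⇒Linked (_ ∷ u) (e ∷ ρ) = e ∷ Route⇒Linked u ρ

  fromWalk : ∀ {x k} → Walk Adj x r k → ∃[ P ] (Route x P × length P ≡ k)
  fromWalk ε = [] , [] , refl
  fromWalk (e ◅ p) with fromWalk p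
  ... | P , ρ , refl = _ ∷ P , e ∷ ρ , refl

  shortcut : ∀ {x P} → Route x P → ∃[ Q ] (Route x Q × Unique (x ∷ Q) × length Q ≤ length P)
  shortcut [] = [] , [] , [] ∷ [] , z≤n
  shortcut {x} (_∷_ {y = y} e ρ) with shortcut ρ
  ... | Q , σ , uQ , Q≤ with x ∈? y ∷ Q
  ...   | no x∉           = y ∷ Q , e ∷ σ , ¬Any⇒All¬ _ x∉ ∷ uQ , s≤s Q≤
  ...   | yes (here refl) = Q , σ , uQ , m≤n⇒m≤1+n Q≤
  ...   | yes (there x∈Q) with ∈-∃++ x∈Q
  ...     | pre , suf , refl =
    suf , Route-drop pre σ , proj₁ (proj₂ (Unique-++⁻ (y ∷ pre) uQ)) ,
    m≤n⇒m≤1+n (≤-trans (<⇒≤ (length-++-≤ʳ (x ∷ suf) {pre})) Q≤)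

  module _ {g : ℕ} (girth : GirthAtLeast G g) where

    -- z is the first vertex of P lying on Q; going out along P to z and back along Q
    -- closes a cycle through a.
    diverging-routes-long : ∀ {a P Q} → head P ≢ head Q → r ∈ P → r ∈ Q →
                            Route a P → Route a Q → Unique (a ∷ P) → Unique (a ∷ Q) →
                            g ≤ length P + length Q
    diverging-routes-long {a} {P} {Q} heads≢ r∈P r∈Q ρ σ uP uQ
      with First.first (λ x → swap (toSum (x ∈? Q))) P
    ... | inj₂ P∉Q = ⊥-elim (All.lookup P∉Q r∈P r∈Q)
    ... | inj₁ P⇝Q with toView P⇝Q
    ...   | First._++_∷_ {u} {z} u∉Q z∈Q w with ∈-∃++ z∈Q
    ...     | v , w′ , refl =
      ≤-trans (girth _ (lookup∷ʳ (a ∷ X) a)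
                (closedWalk-isCycle a X closed (Unique-cycle u w v w′ uP uQ u∉Q) (nondegenerate u v heads≢)))
              (cycle-shorter u z w v w′)
      where
      X : List (Fin n)
      X = u ++ z ∷ reverse v
      closed : Linked Adj (a ∷ X ∷ʳ a)
      closed = subst (λ xs → Linked Adj (a ∷ xs)) (sym (++-assoc u (z ∷ reverse v) [ a ]))
                 (Linked-join (a ∷ u) (Route⇒Linked u ρ) (Linked-reverse Adj-sym v (Route⇒Linked v σ)))
      nondegenerate : ∀ u v {w w′} → head (u ++ z ∷ w) ≢ head (v ++ z ∷ w′) →
                      2 ≤ length (u ++ z ∷ reverse v)
      nondegenerate (_ ∷ u) v       _      = s≤s (≤-trans (s≤s z≤n) (length-++-≤ʳ (z ∷ reverse v) {u}))
      nondegenerate []      (y ∷ v) _      = s≤s (subst (1 ≤_) (sym (length-reverse (y ∷ v))) (s≤s z≤n))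
      nondegenerate []      []      heads≢ = ⊥-elim (heads≢ refl)

    distinct-routes-long : ∀ {a P Q} → Route a P → Route a Q → Unique (a ∷ P) → Unique (a ∷ Q) →
                           P ≢ Q → g ≤ length P + length Q
    distinct-routes-long []      []      _          _          P≢Q = ⊥-elim (P≢Q refl)
    distinct-routes-long []      (_ ∷ σ) _          (r∉Q ∷ _)  _   = ⊥-elim (All.lookup r∉Q (root-∈ σ) refl)
    distinct-routes-long (_ ∷ ρ) []      (r∉P ∷ _)  _          _   = ⊥-elim (All.lookup r∉P (root-∈ ρ) refl)
    distinct-routes-long (_∷_ {y = b} e ρ) (_∷_ {y = c} e′ σ) uP@(_ ∷ uP′) uQ@(_ ∷ uQ′) P≢Q with b ≟ c
    ... | no b≢c   =
      diverging-routes-long (b≢c ∘ just-injective) (root-∈ ρ) (root-∈ σ) (e ∷ ρ) (e′ ∷ σ) uP uQ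
    ... | yes refl = ≤-trans (distinct-routes-long ρ σ uP′ uQ′ (P≢Q ∘ cong (b ∷_)))
                             (+-mono-≤ (n≤1+n _) (n≤1+n _))

  module Ball (D : ℕ) (girth : GirthAtLeast G (3 + 2 * D)) where

    record ShortRoute (x : Fin n) : Set where
      constructor shortRoute
      field
        rest   : List (Fin n)
        route  : Route x rest
        simple : Unique (x ∷ rest)
        short  : length rest ≤ D
    open ShortRoute

    routes-unique : ∀ {x P Q} → Route x P → Route x Q → Unique (x ∷ P) → Unique (x ∷ Q) →
                    length P ≤ suc D → length Q ≤ suc D → P ≡ Q
    routes-unique {P = P} {Q} ρ σ uP uQ P≤ Q≤ with ≡-dec _≟_ P Q
    ... | yes P≡Q = P≡Q
    ... | no  P≢Q = ⊥-elim (≤⇒≯ (+-mono-≤ P≤ Q≤)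
                                (subst (_≤ length P + length Q) (girth-bound D)
                                       (distinct-routes-long girth ρ σ uP uQ P≢Q)))
      where
      girth-bound : ∀ D → 3 + 2 * D ≡ suc (suc D + suc D)
      girth-bound = solve-∀

    route-unique : ∀ {x y} → x ≡ y → (ρ : ShortRoute x) (σ : ShortRoute y) → rest ρ ≡ rest σ
    route-unique refl ρ σ =
      routes-unique (route ρ) (route σ) (simple ρ) (simple σ) (m≤n⇒m≤1+n (short ρ)) (m≤n⇒m≤1+n (short σ))

    route-via : ∀ {x y} → Adj y x → (ρ : ShortRoute x) → y ∉ rest ρ →
                (σ : ShortRoute y) → rest σ ≡ x ∷ rest ρ
    route-via e ρ y∉ σ =
      routes-unique (route σ) (e ∷ route ρ) (simple σ) (¬Any⇒All¬ _ y∉x∷ρ ∷ simple ρ)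
                    (m≤n⇒m≤1+n (short σ)) (s≤s (short ρ))
      where
      y∉x∷ρ : _ ∉ _ ∷ rest ρ
      y∉x∷ρ (here refl) = irr e
      y∉x∷ρ (there y∈)  = y∉ y∈

    adjacent-routes : ∀ {x y} → Adj x y → (ρ : ShortRoute x) (σ : ShortRoute y) →
                      rest σ ≡ x ∷ rest ρ ⊎ rest ρ ≡ y ∷ rest σ
    adjacent-routes {x} {y} e ρ@(shortRoute P α uP P≤) σ@(shortRoute Q β uQ Q≤) with y ∈? P | x ∈? Q
    ... | no y∉P  | _       = inj₁ (route-via (Adj-sym e) ρ y∉P σ)
    ... | yes _   | no x∉Q  = inj₂ (route-via e σ x∉Q ρ)
    ... | yes y∈P | yes x∈Q with ∈-∃++ y∈P
    ...   | pre , suf , refl =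
      ⊥-elim (Unique[x∷xs]⇒x∉xs uP (∈-++⁺ʳ pre (there (subst (x ∈_) (sym suf≡Q) x∈Q))))
      where
      suf≡Q : suf ≡ Q
      suf≡Q = routes-unique (Route-drop pre α) β (proj₁ (proj₂ (Unique-++⁻ (x ∷ pre) uP))) uQ
                (m≤n⇒m≤1+n (≤-trans (<⇒≤ (length-++-≤ʳ (y ∷ suf) {pre})) P≤)) (m≤n⇒m≤1+n Q≤)

    module _ {V : Fin n → Set} {E : Fin n → Fin n → Set}
             (E⊆Adj : ∀ {x y} → E x y → Adj x y) (E⇒V : ∀ {x y} → E x y → V x)
             (shortRoute-of : ∀ {x} → V x → ShortRoute x) where

      no-cycle : ∀ m c → ¬ IsCycle E m c
      no-cycle zero     c (() , _)
      no-cycle (suc m′) c cycle =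
        peakless-steps-not-closed step (cong length) (cong length) no-peak no-wrapped-peak (cong length wrap)
        where
        open CycleVertices {E = E} {c = c} cycle
        route-at : ∀ i → ShortRoute (at i)
        route-at i = shortRoute-of (E⇒V (proj₂ (step-from i)))
        ancestors : ℕ → List (Fin n)
        ancestors i = rest (route-at i)
        wrap : ancestors m ≡ ancestors 0
        wrap = route-unique (at-saturates ≤-refl) (route-at m) (route-at 0)
        step : ∀ i → i ≤ m′ →
               ancestors (suc i) ≡ at i ∷ ancestors i ⊎ ancestors i ≡ at (suc i) ∷ ancestors (suc i)
        step i i≤m′ = adjacent-routes (E⊆Adj (at-step (s≤s i≤m′))) (route-at i) (route-at (suc i))
        no-peak : ∀ i → suc i ≤ m′ → ancestors (suc i) ≡ at i ∷ ancestors i →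
                  ancestors (suc i) ≡ at (suc (suc i)) ∷ ancestors (suc (suc i)) → ⊥
        no-peak i 2+i≤m up down = two-apart-distinct i (s≤s 2+i≤m) (∷-injectiveˡ (trans (sym up) down))
        no-wrapped-peak : ancestors m ≡ at m′ ∷ ancestors m′ → ancestors 0 ≡ at 1 ∷ ancestors 1 → ⊥
        no-wrapped-peak up down = two-apart-across-start (∷-injectiveˡ (trans (sym up) (trans wrap down)))

ball-isTree : ∀ {n} (G : Graph n) (r : Fin n) (D : ℕ) → GirthAtLeast G (3 + 2 * D) →
              {V : Fin n → Set} {E : Fin n → Fin n → Set} →
              Symmetric E → (∀ {x y} → E x y → Graph.Adj G x y) → (∀ {x y} → E x y → V x) →
              (∀ {x} → V x → ∃[ q ] (q ≤ D × Walk E x r q)) → IsTree V E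
ball-isTree G r D girth {V} {E} E-sym E⊆Adj E⇒V reach = connected , no-cycle E⊆Adj E⇒V shortRoute-of
  where
  open Routes G r
  open Ball D girth
  connected : ∀ x y → V x → V y → WalkFromTo E x y
  connected x y x∈V y∈V with reach x∈V | reach y∈V
  ... | _ , _ , p | _ , _ , q = toWalkFromTo (p ◅◅ reverseʷ E-sym q)
  shortRoute-of : ∀ {x} → V x → ShortRoute x
  shortRoute-of x∈V with reach x∈V
  ... | q , q≤D , p with fromWalk (mapʷ E⊆Adj p)
  ...   | P , ρ , refl with shortcut ρ
  ...     | Q , σ , uQ , Q≤P = shortRoute Q σ uQ (≤-trans Q≤P q≤D)

radius : ℕ → ℕ → ℕ
radius l i = (1 + 2 * i) * l

radius-mono : ∀ l {i j} → i ≤ j → radius l i ≤ radius l j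
radius-mono l i≤j = *-monoˡ-≤ l (+-monoʳ-≤ 1 (*-monoʳ-≤ 2 i≤j))

module _ {n : ℕ} {G : Graph n} {l k h : ℕ} .{{_ : NonZero k}} (Wt : Witness G l k h) where
  open Witness Wt
  open Graph G renaming (sym to Adj-sym)

  walk-length-positive : 1 ≤ h → Fin k → 1 ≤ l
  walk-length-positive 1≤h a with level1 1≤h a
  ... | (x , x∈child , x∈root) , inside with inside x x∈child x∈root
  ...   | t , p<t , _ = ≤-trans (s≤s z≤n) (≤-trans p<t (toℕ≤pred[n] t))

  meets-father : ∀ i → suc i ≤ h → (a : Addr k (suc i)) →
                 ∃[ x ] (OnWalk (walk (suc i) a) x × OnWalk (walk i (father i a)) x)
  meets-father zero    1≤h   a       = proj₁ (level1 1≤h a)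
  meets-father (suc i) 2+i≤h (a , c) = proj₁ (levelSS i 2+i≤h a c)

  module _ (j : ℕ) (j≤h : j ≤ h) where

    root : Fin n
    root = walk 0 tt fzero

    EH-sym : Symmetric (EH j)
    EH-sym (i , i≤j , a , t , inj₁ (x≡ , y≡)) = i , i≤j , a , t , inj₂ (x≡ , y≡)
    EH-sym (i , i≤j , a , t , inj₂ (y≡ , x≡)) = i , i≤j , a , t , inj₁ (y≡ , x≡)

    walk-step : ∀ {i} → i ≤ j → (a : Addr k i) (t : Fin l) → Adj (walk i a (inject₁ t)) (walk i a (fsuc t))
    walk-step {i} i≤j a = proj₂ (walk-ok i (≤-trans i≤j j≤h) a)

    EH⊆Adj : ∀ {x y} → EH j x y → Adj x y
    EH⊆Adj (i , i≤j , a , t , inj₁ (x≡ , y≡)) = subst₂ Adj x≡ y≡ (walk-step i≤j a t)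
    EH⊆Adj (i , i≤j , a , t , inj₂ (y≡ , x≡)) = Adj-sym (subst₂ Adj y≡ x≡ (walk-step i≤j a t))

    EH⇒VH : ∀ {x y} → EH j x y → VH j x
    EH⇒VH (i , i≤j , a , t , inj₁ (x≡ , _)) = i , i≤j , a , inject₁ t , x≡
    EH⇒VH (i , i≤j , a , t , inj₂ (_ , x≡)) = i , i≤j , a , fsuc t , x≡

    along : ∀ {i} → i ≤ j → (a : Addr k i) (t : Fin (suc l)) →
            Walk (EH j) (walk i a fzero) (walk i a t) (toℕ t)
    along i≤j a = prefixWalk (walk _ a) (λ t → _ , i≤j , a , t , inj₁ (refl , refl))

    reach-root : ∀ i → i ≤ j → (a : Addr k i) (t : Fin (suc l)) →
                 ∃[ q ] (q ≤ radius l i × Walk (EH j) (walk i a t) root q)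
    reach-root zero 0≤j tt t =
      toℕ t , ≤-trans (toℕ≤pred[n] t) (m≤m+n l 0) , reverseʷ EH-sym (along 0≤j tt t)
    reach-root (suc i) i<j a t with meets-father i (≤-trans i<j j≤h) a
    ... | x , (s , wₛ≡x) , (s′ , w′ₛ′≡x) with reach-root i (<⇒≤ i<j) (father i a) s′
    ...   | q , q≤ , p =
      toℕ t + (toℕ s + q) ,
      ≤-trans (+-mono-≤ (toℕ≤pred[n] t) (+-mono-≤ (toℕ≤pred[n] s) q≤)) (≤-reflexive (radius-suc i l)) ,
      reverseʷ EH-sym (along i<j a t) ◅◅ along i<j a s ◅◅
        subst (λ y → Walk (EH j) y root q) (trans w′ₛ′≡x (sym wₛ≡x)) p
      where
      radius-suc : ∀ i l → l + (l + (1 + 2 * i) * l) ≡ (1 + 2 * suc i) * l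
      radius-suc = solve-∀

    H-isTree : GirthAtLeast G (3 + 2 * radius l j) → IsTree (VH j) (EH j)
    H-isTree girth = ball-isTree G root _ girth EH-sym EH⊆Adj EH⇒VH reach
      where
      reach : ∀ {x} → VH j x → ∃[ q ] (q ≤ radius l j × Walk (EH j) x root q)
      reach (i , i≤j , a , t , wₜ≡x) with reach-root i i≤j a t
      ... | q , q≤ , p = q , ≤-trans q≤ (radius-mono l i≤j) , subst (λ y → Walk (EH j) y root q) wₜ≡x p

girth-budget : ∀ {h l j} → 1 ≤ h → 1 ≤ l → j ≤ h → 3 + 2 * radius l j ≤ 10 * h * l
girth-budget {suc h′} {suc l′} {j} _ _ j≤h = begin
  3 + 2 * radius (suc l′) j
    ≤⟨ +-monoʳ-≤ 3 (*-monoʳ-≤ 2 (radius-mono (suc l′) j≤h)) ⟩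
  3 + 2 * radius (suc l′) (suc h′)
    ≤⟨ m≤m+n _ _ ⟩
  3 + 2 * radius (suc l′) (suc h′) + (6 * h′ * l′ + 6 * h′ + 4 * l′ + 1)
    ≡⟨ slack h′ l′ ⟩
  10 * suc h′ * suc l′ ∎
  where
  open ≤-Reasoning
  slack : ∀ h′ l′ →
          3 + 2 * ((1 + 2 * suc h′) * suc l′) + (6 * h′ * l′ + 6 * h′ + 4 * l′ + 1) ≡ 10 * suc h′ * suc l′
  slack = solve-∀

GirthAtLeast-weaken : ∀ {n} (G : Graph n) {g g′} → g′ ≤ g → GirthAtLeast G g → GirthAtLeast G g′
GirthAtLeast-weaken G g′≤g girth m c cycle = ≤-trans g′≤g (girth m c cycle)

mainTheorem13 : ∀ {n d : ℕ} (G : Graph n) → Regular G d →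
    (l h k : ℕ) → 1 ≤ h → 4 ≤ k → .{{_ : NonZero k}} →
    (Wt : Witness G l k h) →
    GirthAtLeast G (10 * h * l) →
    ∀ j → j ≤ h → IsTree (Witness.VH Wt j) (Witness.EH Wt j)
mainTheorem13 G _ l h (suc k) 1≤h _ Wt girth j j≤h =
  H-isTree Wt j j≤h
    (GirthAtLeast-weaken G (girth-budget 1≤h (walk-length-positive Wt 1≤h fzero) j≤h) girth)
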